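{- Let $\Gamma$ be a set of patterns and $\varphi,\psi,\chi,\theta$ patterns such that $\varphi$ is a subpattern of $\chi$ and $\theta$ is obtained from $\chi$ by replacing one or more occurrences of $\varphi$ with $\psi$. If $\Gamma\vdash_{\mathcal{MG}^c}\varphi=\psi$, then $\Gamma\vdash_{\mathcal{MG}^c}\chi=\theta$.
   Context: Fix a countably infinite set $EVar$ of element variables and a set $\Sigma$ of constant symbols containing a distinguished "definedness symbol" $\lceil\,\rceil$. Patterns: $\varphi::= x\mid \sigma\mid \bot\mid \neg\varphi\mid \varphi\to\varphi\mid \varphi\wedge\varphi\mid\varphi\vee\varphi\mid \varphi\cdot\varphi\mid \forall x\varphi\mid\exists x\varphi$ ($\varphi\cdot\psi$ is application). Abbreviations: $\varphi\leftrightarrow\psi:=(\varphi\to\psi)\wedge(\psi\to\varphi)$, $\lceil\varphi\rceil:=\lceil\,\rceil\cdot\varphi$, $\lfloor\varphi\rfloor:=\neg\lceil\neg\varphi\rceil$, $\varphi=\psi:=\lfloor\varphi\leftrightarrow\psi\rfloor$. Replacement of occurrences is literal (no renaming of bound variables). $\Gamma\vdash\psi$ means there is a finite sequence ending in $\psi$ of axiom instances, elements of $\Gamma$, or consequences of earlier members by rules. Proof system $\mathcal{MG}^c$. Axioms: $\varphi\vee\varphi\to\varphi$; $\varphi\to\varphi\wedge\varphi$; $\varphi\to\varphi\vee\psi$; $\varphi\wedge\psi\to\varphi$; $\varphi\vee\psi\to\psi\vee\varphi$; $\varphi\wedge\psi\to\psi\wedge\varphi$; $\bot\to\varphi$; $\varphi\vee\neg\varphi$;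 $\neg\varphi\to(\varphi\to\bot)$; $(\varphi\to\bot)\to\neg\varphi$; $\forall x(\varphi\to\psi)\to(\forall x\varphi\to\forall x\psi)$; $\varphi\to\forall x\varphi$ if $x$ does not occur in $\varphi$; $\exists x(x=y)$ for $y$ distinct from $x$; $\exists x\varphi\to\neg\forall x\neg\varphi$; $\neg\forall x\neg\varphi\to\exists x\varphi$; $(\varphi\vee\psi)\cdot\chi\to\varphi\cdot\chi\vee\psi\cdot\chi$; $\chi\cdot(\varphi\vee\psi)\to\chi\cdot\varphi\vee\chi\cdot\psi$; $(\exists x\varphi)\cdot\psi\to\exists x(\varphi\cdot\psi)$ and $\psi\cdot(\exists x\varphi)\to\exists x(\psi\cdot\varphi)$ if $x$ does not occur in $\psi$; $\lceil\varphi\rceil\cdot\psi\to\lceil\varphi\rceil$; $\psi\cdot\lceil\varphi\rceil\to\lceil\varphi\rceil$; $\lceil x\rceil$; $\varphi\to\lceil\varphi\rceil$; $\lceil\bot\rceil\to\bot$. Rules: from $\varphi$, $\varphi\to\psi$ infer $\psi$; from $\varphi\to\psi$, $\psi\to\chi$ infer $\varphi\to\chi$; from $\varphi\wedge\psi\to\chi$ infer $\varphi\to(\psi\to\chi)$; from $\varphi\to(\psi\to\chi)$ infer $\varphi\wedge\psi\to\chi$; from $\varphi\to\psi$ infer $\chi\vee\varphi\to\chi\vee\psi$; from $\varphi$ infer $\forall x\varphi$; from $\varphi\to\psi$ infer $\varphi\cdot\chi\to\psi\cdot\chi$ and $\chi\cdot\varphi\to\chi\cdot\psi$. -}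

module Defs where

open import Data.Nat using (ℕ)
open import Relation.Binary.PropositionalEquality using (_≡_)
open import Relation.Nullary using (¬_)
open import Data.Product using (_×_)
open import Data.Sum using (_⊎_)

EVar : Set
EVar = ℕ

data Pattern (Sym : Set) : Set where
  var  : EVar → Pattern Sym
  sym  : Sym → Pattern Sym
  ⊥p   : Pattern Sym
  ¬p_  : Pattern Sym → Pattern Sym
  _⇒_  : Pattern Sym → Pattern Sym → Pattern Sym
  _∧p_ : Pattern Sym → Pattern Sym → Pattern Sym
  _∨p_ : Pattern Sym → Pattern Sym → Pattern Sym
  _·_  : Pattern Sym → Pattern Sym → Pattern Sym
  ∀p   : EVar → Pattern Sym → Pattern Sym
  ∃p   : EVar → Pattern Sym → Pattern Sym

infixr 4 _⇒_
infixl 6 _∧p_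
infixl 5 _∨p_
infixl 7 _·_

module _ {Sym : Set} where

  data Occurs (x : EVar) : Pattern Sym → Set where
    o-var  : Occurs x (var x)
    o-¬    : ∀ {a} → Occurs x a → Occurs x (¬p a)
    o-⇒l   : ∀ {a b} → Occurs x a → Occurs x (a ⇒ b)
    o-⇒r   : ∀ {a b} → Occurs x b → Occurs x (a ⇒ b)
    o-∧l   : ∀ {a b} → Occurs x a → Occurs x (a ∧p b)
    o-∧r   : ∀ {a b} → Occurs x b → Occurs x (a ∧p b)
    o-∨l   : ∀ {a b} → Occurs x a → Occurs x (a ∨p b)
    o-∨r   : ∀ {a b} → Occurs x b → Occurs x (a ∨p b)
    o-·l   : ∀ {a b} → Occurs x a → Occurs x (a · b)
    o-·r   : ∀ {a b} → Occurs x b → Occurs x (a · b)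
    o-∀b   : ∀ {a} → Occurs x (∀p x a)
    o-∀    : ∀ {y a} → Occurs x a → Occurs x (∀p y a)
    o-∃b   : ∀ {a} → Occurs x (∃p x a)
    o-∃    : ∀ {y a} → Occurs x a → Occurs x (∃p y a)

  data Subpattern (φ : Pattern Sym) : Pattern Sym → Set where
    sp-refl : Subpattern φ φ
    sp-¬    : ∀ {a} → Subpattern φ a → Subpattern φ (¬p a)
    sp-⇒l   : ∀ {a b} → Subpattern φ a → Subpattern φ (a ⇒ b)
    sp-⇒r   : ∀ {a b} → Subpattern φ b → Subpattern φ (a ⇒ b)
    sp-∧l   : ∀ {a b} → Subpattern φ a → Subpattern φ (a ∧p b)
    sp-∧r   : ∀ {a b} → Subpattern φ b → Subpattern φ (a ∧p b)
    sp-∨l   : ∀ {a b} → Subpattern φ a → Subpattern φ (a ∨p b)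
    sp-∨r   : ∀ {a b} → Subpattern φ b → Subpattern φ (a ∨p b)
    sp-·l   : ∀ {a b} → Subpattern φ a → Subpattern φ (a · b)
    sp-·r   : ∀ {a b} → Subpattern φ b → Subpattern φ (a · b)
    sp-∀    : ∀ {y a} → Subpattern φ a → Subpattern φ (∀p y a)
    sp-∃    : ∀ {y a} → Subpattern φ a → Subpattern φ (∃p y a)

  -- ReplAny φ ψ χ θ : θ arises from χ by literally replacing zero or more
  -- occurrences of φ by ψ (no renaming of bound variables).
  data ReplAny (φ ψ : Pattern Sym) : Pattern Sym → Pattern Sym → Set where
    ra-keep : ∀ {a} → ReplAny φ ψ a a
    ra-here : ReplAny φ ψ φ ψ
    ra-¬    : ∀ {a a'} → ReplAny φ ψ a a' → ReplAny φ ψ (¬p a) (¬p a')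
    ra-⇒    : ∀ {a a' b b'} → ReplAny φ ψ a a' → ReplAny φ ψ b b' → ReplAny φ ψ (a ⇒ b) (a' ⇒ b')
    ra-∧    : ∀ {a a' b b'} → ReplAny φ ψ a a' → ReplAny φ ψ b b' → ReplAny φ ψ (a ∧p b) (a' ∧p b')
    ra-∨    : ∀ {a a' b b'} → ReplAny φ ψ a a' → ReplAny φ ψ b b' → ReplAny φ ψ (a ∨p b) (a' ∨p b')
    ra-·    : ∀ {a a' b b'} → ReplAny φ ψ a a' → ReplAny φ ψ b b' → ReplAny φ ψ (a · b) (a' · b')
    ra-∀    : ∀ {y a a'} → ReplAny φ ψ a a' → ReplAny φ ψ (∀p y a) (∀p y a')
    ra-∃    : ∀ {y a a'} → ReplAny φ ψ a a' → ReplAny φ ψ (∃p y a) (∃p y a')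

  data ReplSome (φ ψ : Pattern Sym) : Pattern Sym → Pattern Sym → Set where
    rs-here : ReplSome φ ψ φ ψ
    rs-¬    : ∀ {a a'} → ReplSome φ ψ a a' → ReplSome φ ψ (¬p a) (¬p a')
    rs-⇒l   : ∀ {a a' b b'} → ReplSome φ ψ a a' → ReplAny φ ψ b b' → ReplSome φ ψ (a ⇒ b) (a' ⇒ b')
    rs-⇒r   : ∀ {a a' b b'} → ReplAny φ ψ a a' → ReplSome φ ψ b b' → ReplSome φ ψ (a ⇒ b) (a' ⇒ b')
    rs-∧l   : ∀ {a a' b b'} → ReplSome φ ψ a a' → ReplAny φ ψ b b' → ReplSome φ ψ (a ∧p b) (a' ∧p b')
    rs-∧r   : ∀ {a a' b b'} → ReplAny φ ψ a a' → ReplSome φ ψ b b' → ReplSome φ ψ (a ∧p b) (a' ∧p b')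
    rs-∨l   : ∀ {a a' b b'} → ReplSome φ ψ a a' → ReplAny φ ψ b b' → ReplSome φ ψ (a ∨p b) (a' ∨p b')
    rs-∨r   : ∀ {a a' b b'} → ReplAny φ ψ a a' → ReplSome φ ψ b b' → ReplSome φ ψ (a ∨p b) (a' ∨p b')
    rs-·l   : ∀ {a a' b b'} → ReplSome φ ψ a a' → ReplAny φ ψ b b' → ReplSome φ ψ (a · b) (a' · b')
    rs-·r   : ∀ {a a' b b'} → ReplAny φ ψ a a' → ReplSome φ ψ b b' → ReplSome φ ψ (a · b) (a' · b')
    rs-∀    : ∀ {y a a'} → ReplSome φ ψ a a' → ReplSome φ ψ (∀p y a) (∀p y a')
    rs-∃    : ∀ {y a a'} → ReplSome φ ψ a a' → ReplSome φ ψ (∃p y a) (∃p y a')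

-- Abbreviations, relative to the distinguished definedness symbol dsym.
module Abbrev {Sym : Set} (dsym : Sym) where

  _⇔_ : Pattern Sym → Pattern Sym → Pattern Sym
  φ ⇔ ψ = (φ ⇒ ψ) ∧p (ψ ⇒ φ)

  ⌈_⌉ : Pattern Sym → Pattern Sym
  ⌈ φ ⌉ = sym dsym · φ

  ⌊_⌋ : Pattern Sym → Pattern Sym
  ⌊ φ ⌋ = ¬p ⌈ ¬p φ ⌉

  _≐_ : Pattern Sym → Pattern Sym → Pattern Sym
  φ ≐ ψ = ⌊ φ ⇔ ψ ⌋

  data Axiom : Pattern Sym → Set where
    ax-∨idem  : ∀ φ → Axiom (φ ∨p φ ⇒ φ)
    ax-∧dup   : ∀ φ → Axiom (φ ⇒ φ ∧p φ)
    ax-∨intro : ∀ φ ψ → Axiom (φ ⇒ φ ∨p ψ)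
    ax-∧elim  : ∀ φ ψ → Axiom (φ ∧p ψ ⇒ φ)
    ax-∨comm  : ∀ φ ψ → Axiom (φ ∨p ψ ⇒ ψ ∨p φ)
    ax-∧comm  : ∀ φ ψ → Axiom (φ ∧p ψ ⇒ ψ ∧p φ)
    ax-⊥      : ∀ φ → Axiom (⊥p ⇒ φ)
    ax-lem    : ∀ φ → Axiom (φ ∨p ¬p φ)
    ax-¬e     : ∀ φ → Axiom (¬p φ ⇒ (φ ⇒ ⊥p))
    ax-¬i     : ∀ φ → Axiom ((φ ⇒ ⊥p) ⇒ ¬p φ)
    ax-∀K     : ∀ x φ ψ → Axiom (∀p x (φ ⇒ ψ) ⇒ (∀p x φ ⇒ ∀p x ψ))
    ax-∀vac   : ∀ x φ → ¬ Occurs x φ → Axiom (φ ⇒ ∀p x φ)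
    ax-∃eq    : ∀ x y → ¬ (x ≡ y) → Axiom (∃p x (var x ≐ var y))
    ax-∃∀     : ∀ x φ → Axiom (∃p x φ ⇒ ¬p ∀p x (¬p φ))
    ax-∀∃     : ∀ x φ → Axiom (¬p ∀p x (¬p φ) ⇒ ∃p x φ)
    ax-prop∨l : ∀ φ ψ χ → Axiom ((φ ∨p ψ) · χ ⇒ φ · χ ∨p ψ · χ)
    ax-prop∨r : ∀ φ ψ χ → Axiom (χ · (φ ∨p ψ) ⇒ χ · φ ∨p χ · ψ)
    ax-prop∃l : ∀ x φ ψ → ¬ Occurs x ψ → Axiom ((∃p x φ) · ψ ⇒ ∃p x (φ · ψ))
    ax-prop∃r : ∀ x φ ψ → ¬ Occurs x ψ → Axiom (ψ · (∃p x φ) ⇒ ∃p x (ψ · φ))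
    ax-⌈⌉l    : ∀ φ ψ → Axiom (⌈ φ ⌉ · ψ ⇒ ⌈ φ ⌉)
    ax-⌈⌉r    : ∀ φ ψ → Axiom (ψ · ⌈ φ ⌉ ⇒ ⌈ φ ⌉)
    ax-defvar : ∀ x → Axiom ⌈ var x ⌉
    ax-def    : ∀ φ → Axiom (φ ⇒ ⌈ φ ⌉)
    ax-def⊥   : Axiom (⌈ ⊥p ⌉ ⇒ ⊥p)

  data _⊢_ (Γ : Pattern Sym → Set) : Pattern Sym → Set where
    axiom  : ∀ {φ} → Axiom φ → Γ ⊢ φ
    hyp    : ∀ {φ} → Γ φ → Γ ⊢ φ
    mp     : ∀ {φ ψ} → Γ ⊢ φ → Γ ⊢ (φ ⇒ ψ) → Γ ⊢ ψ
    syll   : ∀ {φ ψ χ} → Γ ⊢ (φ ⇒ ψ) → Γ ⊢ (ψ ⇒ χ) → Γ ⊢ (φ ⇒ χ)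
    exp    : ∀ {φ ψ χ} → Γ ⊢ (φ ∧p ψ ⇒ χ) → Γ ⊢ (φ ⇒ (ψ ⇒ χ))
    imp    : ∀ {φ ψ χ} → Γ ⊢ (φ ⇒ (ψ ⇒ χ)) → Γ ⊢ (φ ∧p ψ ⇒ χ)
    ∨mono  : ∀ {φ ψ} χ → Γ ⊢ (φ ⇒ ψ) → Γ ⊢ (χ ∨p φ ⇒ χ ∨p ψ)
    gen    : ∀ {φ} x → Γ ⊢ φ → Γ ⊢ ∀p x φ
    frameL : ∀ {φ ψ} χ → Γ ⊢ (φ ⇒ ψ) → Γ ⊢ (φ · χ ⇒ ψ · χ)
    frameR : ∀ {φ ψ} χ → Γ ⊢ (φ ⇒ ψ) → Γ ⊢ (χ · φ ⇒ χ · ψ)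

  infix 2 _⊢_

{-# OPTIONS --safe #-}
module Submission where

open import Data.Product using (_×_; _,_)
open import Defs

-- From Γ ⊢ ⌊φ ↔ ψ⌋ one recovers Γ ⊢ φ ↔ ψ, because ⌈·⌉ is extensive (φ → ⌈φ⌉).
-- Mutual derivability is a congruence for every constructor, binders included:
-- generalisation carries no side condition, so ∀ and ∃ respect it without any
-- renaming. Hence Γ ⊢ χ ↔ θ, and ⌊·⌋ is closed under necessitation, since
-- framing ¬(χ ↔ θ) → ⊥ under ⌈·⌉ and using ⌈⊥⌉ → ⊥ refutes ⌈¬(χ ↔ θ)⌉.

replSome⇒replAny : {Sym : Set} {φ ψ a b : Pattern Sym} →
                   ReplSome φ ψ a b → ReplAny φ ψ a b
replSome⇒replAny rs-here     = ra-here
replSome⇒replAny (rs-¬ r)    = ra-¬ (replSome⇒replAny r)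
replSome⇒replAny (rs-⇒l r s) = ra-⇒ (replSome⇒replAny r) s
replSome⇒replAny (rs-⇒r r s) = ra-⇒ r (replSome⇒replAny s)
replSome⇒replAny (rs-∧l r s) = ra-∧ (replSome⇒replAny r) s
replSome⇒replAny (rs-∧r r s) = ra-∧ r (replSome⇒replAny s)
replSome⇒replAny (rs-∨l r s) = ra-∨ (replSome⇒replAny r) s
replSome⇒replAny (rs-∨r r s) = ra-∨ r (replSome⇒replAny s)
replSome⇒replAny (rs-·l r s) = ra-· (replSome⇒replAny r) s
replSome⇒replAny (rs-·r r s) = ra-· r (replSome⇒replAny s)
replSome⇒replAny (rs-∀ r)    = ra-∀ (replSome⇒replAny r)
replSome⇒replAny (rs-∃ r)    = ra-∃ (replSome⇒replAny r)

module Derivable {Sym : Set} (dsym : Sym) (Γ : Pattern Sym → Set) where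
  open Abbrev dsym

  private
    variable
      a a' b b' c : Pattern Sym

  ⇒-refl : Γ ⊢ a ⇒ a
  ⇒-refl {a} = syll (axiom (ax-∧dup a)) (axiom (ax-∧elim a a))

  K : Γ ⊢ a ⇒ (b ⇒ a)
  K {a} {b} = exp (axiom (ax-∧elim a b))

  ∧-intro : Γ ⊢ a → Γ ⊢ b → Γ ⊢ a ∧p b
  ∧-intro ⊢a ⊢b = mp ⊢b (mp ⊢a (exp ⇒-refl))

  ∧-proj₁ : Γ ⊢ a ∧p b → Γ ⊢ a
  ∧-proj₁ {a} {b} ⊢a∧b = mp ⊢a∧b (axiom (ax-∧elim a b))

  ∧-proj₂ : Γ ⊢ a ∧p b → Γ ⊢ b
  ∧-proj₂ {a} {b} ⊢a∧b = ∧-proj₁ (mp ⊢a∧b (axiom (ax-∧comm a b)))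

  ∧-mapˡ : Γ ⊢ a ⇒ a' → Γ ⊢ a ∧p b ⇒ a' ∧p b
  ∧-mapˡ a⇒a' = imp (syll a⇒a' (exp ⇒-refl))

  ∧-mapʳ : Γ ⊢ b ⇒ b' → Γ ⊢ a ∧p b ⇒ a ∧p b'
  ∧-mapʳ {b} {b'} {a} b⇒b' =
    syll (axiom (ax-∧comm a b)) (syll (∧-mapˡ b⇒b') (axiom (ax-∧comm b' a)))

  ∧-map : Γ ⊢ a ⇒ a' → Γ ⊢ b ⇒ b' → Γ ⊢ a ∧p b ⇒ a' ∧p b'
  ∧-map a⇒a' b⇒b' = syll (∧-mapˡ a⇒a') (∧-mapʳ b⇒b')

  ∧-pair : Γ ⊢ c ⇒ a → Γ ⊢ c ⇒ b → Γ ⊢ c ⇒ a ∧p b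
  ∧-pair {c} c⇒a c⇒b = syll (axiom (ax-∧dup c)) (∧-map c⇒a c⇒b)

  discharge : Γ ⊢ c ⇒ (a ⇒ b) → Γ ⊢ a → Γ ⊢ c ⇒ b
  discharge c⇒a⇒b ⊢a = syll (∧-pair ⇒-refl (mp ⊢a K)) (imp c⇒a⇒b)

  ∨-map : Γ ⊢ a ⇒ a' → Γ ⊢ b ⇒ b' → Γ ⊢ a ∨p b ⇒ a' ∨p b'
  ∨-map {a} {a'} {b} {b'} a⇒a' b⇒b' =
    syll (∨mono a b⇒b')
         (syll (axiom (ax-∨comm a b')) (syll (∨mono b' a⇒a') (axiom (ax-∨comm b' a'))))

  ∨-elim : Γ ⊢ a ⇒ c → Γ ⊢ b ⇒ c → Γ ⊢ a ∨p b ⇒ c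
  ∨-elim {c = c} a⇒c b⇒c = syll (∨-map a⇒c b⇒c) (axiom (ax-∨idem c))

  ⇒-map : Γ ⊢ a' ⇒ a → Γ ⊢ b ⇒ b' → Γ ⊢ (a ⇒ b) ⇒ (a' ⇒ b')
  ⇒-map a'⇒a b⇒b' =
    exp (syll (∧-mapʳ a'⇒a) (syll (imp ⇒-refl) b⇒b'))

  contraposition : Γ ⊢ a' ⇒ a → Γ ⊢ ¬p a ⇒ ¬p a'
  contraposition {a'} {a} a'⇒a =
    syll (syll (axiom (ax-¬e a)) (⇒-map a'⇒a ⇒-refl)) (axiom (ax-¬i a'))

  ¬¬-elim : Γ ⊢ ¬p ¬p a ⇒ a
  ¬¬-elim {a} = mp (axiom (ax-lem a)) (∨-elim K ¬a⇒¬¬a⇒a)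
    where
      ¬a⇒¬¬a⇒a : Γ ⊢ ¬p a ⇒ (¬p ¬p a ⇒ a)
      ¬a⇒¬¬a⇒a = exp (syll (axiom (ax-∧comm (¬p a) (¬p ¬p a)))
                          (syll (imp (axiom (ax-¬e (¬p a)))) (axiom (ax-⊥ a))))

  ∀-map : ∀ x → Γ ⊢ a ⇒ a' → Γ ⊢ ∀p x a ⇒ ∀p x a'
  ∀-map {a} {a'} x a⇒a' = mp (gen x a⇒a') (axiom (ax-∀K x a a'))

  ∃-map : ∀ x → Γ ⊢ a ⇒ a' → Γ ⊢ ∃p x a ⇒ ∃p x a'
  ∃-map {a} {a'} x a⇒a' =
    syll (axiom (ax-∃∀ x a))
         (syll (contraposition (∀-map x (contraposition a⇒a'))) (axiom (ax-∀∃ x a')))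

  ·-map : Γ ⊢ a ⇒ a' → Γ ⊢ b ⇒ b' → Γ ⊢ a · b ⇒ a' · b'
  ·-map {a' = a'} {b = b} a⇒a' b⇒b' = syll (frameL b a⇒a') (frameR a' b⇒b')

  ⌊⌋-elim : Γ ⊢ ⌊ a ⌋ → Γ ⊢ a
  ⌊⌋-elim {a} ⊢⌊a⌋ = mp (mp ⊢⌊a⌋ (contraposition (axiom (ax-def (¬p a))))) ¬¬-elim

  ⌊⌋-intro : Γ ⊢ a → Γ ⊢ ⌊ a ⌋
  ⌊⌋-intro {a} ⊢a = mp ⌈¬a⌉⇒⊥ (axiom (ax-¬i ⌈ ¬p a ⌉))
    where
      ⌈¬a⌉⇒⊥ : Γ ⊢ ⌈ ¬p a ⌉ ⇒ ⊥p
      ⌈¬a⌉⇒⊥ = syll (frameR (sym dsym) (discharge (axiom (ax-¬e a)) ⊢a)) (axiom ax-def⊥)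

  infix 3 _⊣⊢_

  _⊣⊢_ : Pattern Sym → Pattern Sym → Set
  a ⊣⊢ b = (Γ ⊢ a ⇒ b) × (Γ ⊢ b ⇒ a)

  ≐⇒⊣⊢ : Γ ⊢ a ≐ b → a ⊣⊢ b
  ≐⇒⊣⊢ ⊢a≐b = let ⊢a⇔b = ⌊⌋-elim ⊢a≐b in ∧-proj₁ ⊢a⇔b , ∧-proj₂ ⊢a⇔b

  ⊣⊢⇒≐ : a ⊣⊢ b → Γ ⊢ a ≐ b
  ⊣⊢⇒≐ (a⇒b , b⇒a) = ⌊⌋-intro (∧-intro a⇒b b⇒a)

  ⊣⊢-refl : a ⊣⊢ a
  ⊣⊢-refl = ⇒-refl , ⇒-refl

  ¬-cong : a ⊣⊢ a' → ¬p a ⊣⊢ ¬p a'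
  ¬-cong (f , g) = contraposition g , contraposition f

  ⇒-cong : a ⊣⊢ a' → b ⊣⊢ b' → (a ⇒ b) ⊣⊢ (a' ⇒ b')
  ⇒-cong (f , g) (f' , g') = ⇒-map g f' , ⇒-map f g'

  ∧-cong : a ⊣⊢ a' → b ⊣⊢ b' → a ∧p b ⊣⊢ a' ∧p b'
  ∧-cong (f , g) (f' , g') = ∧-map f f' , ∧-map g g'

  ∨-cong : a ⊣⊢ a' → b ⊣⊢ b' → a ∨p b ⊣⊢ a' ∨p b'
  ∨-cong (f , g) (f' , g') = ∨-map f f' , ∨-map g g'

  ·-cong : a ⊣⊢ a' → b ⊣⊢ b' → a · b ⊣⊢ a' · b'
  ·-cong (f , g) (f' , g') = ·-map f f' , ·-map g g'

  ∀-cong : ∀ x → a ⊣⊢ a' → ∀p x a ⊣⊢ ∀p x a'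
  ∀-cong x (f , g) = ∀-map x f , ∀-map x g

  ∃-cong : ∀ x → a ⊣⊢ a' → ∃p x a ⊣⊢ ∃p x a'
  ∃-cong x (f , g) = ∃-map x f , ∃-map x g

  replAny-⊣⊢ : {φ ψ : Pattern Sym} → φ ⊣⊢ ψ → ReplAny φ ψ a b → a ⊣⊢ b
  replAny-⊣⊢ φ⊣⊢ψ ra-keep      = ⊣⊢-refl
  replAny-⊣⊢ φ⊣⊢ψ ra-here      = φ⊣⊢ψ
  replAny-⊣⊢ φ⊣⊢ψ (ra-¬ r)     = ¬-cong (replAny-⊣⊢ φ⊣⊢ψ r)
  replAny-⊣⊢ φ⊣⊢ψ (ra-⇒ r s)   = ⇒-cong (replAny-⊣⊢ φ⊣⊢ψ r) (replAny-⊣⊢ φ⊣⊢ψ s)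
  replAny-⊣⊢ φ⊣⊢ψ (ra-∧ r s)   = ∧-cong (replAny-⊣⊢ φ⊣⊢ψ r) (replAny-⊣⊢ φ⊣⊢ψ s)
  replAny-⊣⊢ φ⊣⊢ψ (ra-∨ r s)   = ∨-cong (replAny-⊣⊢ φ⊣⊢ψ r) (replAny-⊣⊢ φ⊣⊢ψ s)
  replAny-⊣⊢ φ⊣⊢ψ (ra-· r s)   = ·-cong (replAny-⊣⊢ φ⊣⊢ψ r) (replAny-⊣⊢ φ⊣⊢ψ s)
  replAny-⊣⊢ φ⊣⊢ψ (ra-∀ {y} r) = ∀-cong y (replAny-⊣⊢ φ⊣⊢ψ r)
  replAny-⊣⊢ φ⊣⊢ψ (ra-∃ {y} r) = ∃-cong y (replAny-⊣⊢ φ⊣⊢ψ r)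

mainTheorem12 : {Sym : Set} (dsym : Sym) (Γ : Pattern Sym → Set)
    (φ ψ χ θ : Pattern Sym) →
    Subpattern φ χ →
    ReplSome φ ψ χ θ →
    Abbrev._⊢_ dsym Γ (Abbrev._≐_ dsym φ ψ) →
    Abbrev._⊢_ dsym Γ (Abbrev._≐_ dsym χ θ)
mainTheorem12 dsym Γ φ ψ χ θ _ χ↝θ ⊢φ≐ψ =
  ⊣⊢⇒≐ (replAny-⊣⊢ (≐⇒⊣⊢ ⊢φ≐ψ) (replSome⇒replAny χ↝θ))
  where open Derivable dsym Γ
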